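{- Let $\mathbb{P}=(\mathcal{G},(\mathcal{D},\sqsubseteq),\delta)$ be a pattern setup. Then $$\mathbb{P}^{\blacktriangledown}=\big(\mathcal{G},(\wp(\mathcal{D}),\subseteq),\ \delta^{\blacktriangledown}:g\mapsto\{d\in\mathcal{D}\mid d\sqsubseteq\delta(g)\}\big)$$ is a pattern structure, with extent operator $ext^{\blacktriangledown}(S)=\bigcap_{d\in S}ext(d)$ for all $S\subseteq\mathcal{D}$, intent operator $int^{\blacktriangledown}(A)=cov(A)$ for all $A\subseteq\mathcal{G}$, and set of definable sets $\mathbb{P}^{\blacktriangledown}_{ext}=\{\bigcap\mathcal{S}\mid\mathcal{S}\subseteq\mathbb{P}_{ext}\}$ (with $\bigcap\emptyset=\mathcal{G}$).
   Context: A pattern setup is a triple $(\mathcal{G},(\mathcal{D},\sqsubseteq),\delta)$ with $\mathcal{G}$ a set, $(\mathcal{D},\sqsubseteq)$ a poset and $\delta:\mathcal{G}\to\mathcal{D}$ a map. Its extent operator is $ext(d)=\{g\in\mathcal{G}\mid d\sqsubseteq\delta(g)\}$, its definable sets $\mathbb{P}_{ext}=\{ext(d)\mid d\in\mathcal{D}\}$, and $cov(A)=\{d\in\mathcal{D}\mid\forall g\in A,\ d\sqsubseteq\delta(g)\}$. A pattern setup is a pattern structure if every subset of $\{\delta(g)\mid g\in\mathcal{G}\}$ (including $\emptyset$) has a meet in the description poset; its intent operator sends $A\subseteq\mathcal{G}$ to the meet of $\{\delta(g)\mid g\in A\}$. For $\mathbb{P}^{\blacktriangledown}$ the extent of $S\subseteq\mathcal{D}$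 is $\{g\mid S\subseteq\delta^{\blacktriangledown}(g)\}$. -}

module Defs where

open import Level using (Level; _⊔_; suc)
open import Relation.Unary using (Pred; _⊆_; _≐_)
open import Data.Product using (Σ; ∃; _×_; proj₁)

-- Subsets are predicates; "subsets of the image of δ" are given as
-- families F : I → D indexed by a type I : Set ι whose members all lie
-- in the image (predicative rendering of arbitrary subsets).
module Setup {a b c} (G : Set a) (D : Set b) (_⊑_ : D → D → Set c) (δ : G → D) where

  ext : D → Pred G c
  ext d g = d ⊑ δ g

  cov : ∀ {ℓ} → Pred G ℓ → Pred D (a ⊔ c ⊔ ℓ)
  cov A d = ∀ g → A g → d ⊑ δ g

  InImage : D → Set (a ⊔ c)
  InImage x = ∃ λ g → (x ⊑ δ g) × (δ g ⊑ x)

  IsMeet : ∀ {ι} {I : Set ι} → (I → D) → D → Set (ι ⊔ b ⊔ c)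
  IsMeet {I = I} F m = (∀ i → m ⊑ F i) × (∀ m' → (∀ i → m' ⊑ F i) → m' ⊑ m)

  IsPatternStructure : (ι : Level) → Set (suc ι ⊔ a ⊔ b ⊔ c)
  IsPatternStructure ι =
    (I : Set ι) (F : I → D) → (∀ i → InImage (F i)) → Σ D (IsMeet F)

  IsIntent : ∀ {ℓ} → Pred G ℓ → D → Set (a ⊔ b ⊔ c ⊔ ℓ)
  IsIntent A m = IsMeet {I = Σ G A} (λ p → δ (proj₁ p)) m

  Definable : ∀ {ℓ} → Pred G ℓ → Set (a ⊔ b ⊔ c ⊔ ℓ)
  Definable A = ∃ λ d → A ≐ ext d

⋂ : ∀ {a ι ℓ} {G : Set a} {I : Set ι} → (I → Pred G ℓ) → Pred G (ι ⊔ ℓ)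
⋂ F g = ∀ i → F i g

module Down {ℓ} (G D : Set ℓ) (_⊑_ : D → D → Set ℓ) (δ : G → D) where

  δ▼ : G → Pred D ℓ
  δ▼ g d = d ⊑ δ g

  module P = Setup G D _⊑_ δ
  module P▼ = Setup G (Pred D ℓ) _⊆_ δ▼

module Submission where

-- The description poset of P▼ is the powerset lattice
-- (℘(D), ⊆), in which every family of subsets has a meet, namely its
-- intersection.  Unfolding the definitions, ext▼(S) = { g | S ⊆ δ▼ g } is the
-- intersection of the ext(d) for d ∈ S, and the meet of { δ▼ g | g ∈ A }
-- is the set of d lying below every δ g with g ∈ A, which is cov(A).
-- Finally, ext▼(S) is the intersection of the definable family
-- (ext d)_{d ∈ S}, and conversely an intersection ⋂ F of definable sets is
-- ext▼ of the set of all d whose extent occurs in F.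

open import Defs
open import Level using (Level)
open import Relation.Binary.PropositionalEquality using (_≡_)
open import Relation.Binary.Structures using (IsPartialOrder)
open import Relation.Unary using (Pred; _⊆_; _≐_)
open import Relation.Unary.Properties using (≐-trans)
open import Data.Product using (Σ; _×_; _,_; proj₁; proj₂)
open import Function.Bundles using (_⇔_; mk⇔)

module Powerset {ℓ} (G X : Set ℓ) (γ : G → Pred X ℓ) where

  open Setup G (Pred X ℓ) _⊆_ γ

  ⋂-isMeet : {I : Set ℓ} (F : I → Pred X ℓ) → IsMeet F (⋂ F)
  ⋂-isMeet F = (λ i x∈⋂F → x∈⋂F i) , (λ m m⊆F x∈m i → m⊆F i x∈m)

  isMeet-resp-≐ : ∀ {ι} {I : Set ι} {F : I → Pred X ℓ} {m m′ : Pred X ℓ} →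
                  m ≐ m′ → IsMeet F m → IsMeet F m′
  isMeet-resp-≐ (m⊆m′ , m′⊆m) (lower , greatest) =
    (λ i x∈m′ → lower i (m′⊆m x∈m′)) , (λ k k⊆F x∈k → m⊆m′ (greatest k k⊆F x∈k))

  isPatternStructure : IsPatternStructure ℓ
  isPatternStructure I F _ = ⋂ F , ⋂-isMeet F

  intent-is-⋂ : (A : Pred G ℓ) → IsIntent A (λ x → ∀ g → A g → γ g x)
  intent-is-⋂ A = isMeet-resp-≐ uncurry-≐ (⋂-isMeet (λ (p : Σ G A) → γ (proj₁ p)))
    where
    uncurry-≐ : ⋂ (λ (p : Σ G A) → γ (proj₁ p)) ≐ (λ x → ∀ g → A g → γ g x)
    uncurry-≐ = (λ x∈⋂ g g∈A → x∈⋂ (g , g∈A)) , (λ x∈γA p → x∈γA (proj₁ p) (proj₂ p))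

module DownSetup {ℓ} (G D : Set ℓ) (_⊑_ : D → D → Set ℓ) (δ : G → D) where

  open Down G D _⊑_ δ

  ext▼-pointwise : (S : Pred D ℓ) → P▼.ext S ≐ (λ g → ∀ d → S d → P.ext d g)
  ext▼-pointwise S = (λ S⊆δ▼g d d∈S → S⊆δ▼g d∈S) , (λ h {d} d∈S → h d d∈S)

  ext▼-is-⋂ : (S : Pred D ℓ) → P▼.ext S ≐ ⋂ (λ (p : Σ D S) → P.ext (proj₁ p))
  ext▼-is-⋂ S = (λ S⊆δ▼g p → S⊆δ▼g (proj₂ p)) , (λ h {d} d∈S → h (d , d∈S))

  ⋂-is-ext▼ : {I : Set ℓ} (F : I → Pred G ℓ) → (∀ i → P.Definable (F i)) →
              ⋂ F ≐ P▼.ext (λ d → Σ I λ i → F i ≐ P.ext d)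
  ⋂-is-ext▼ {I} F definable = in-ext▼ , in-⋂
    where
    in-ext▼ : ⋂ F ⊆ P▼.ext (λ d → Σ I λ i → F i ≐ P.ext d)
    in-ext▼ g∈⋂F (i , Fi⊆ext , _) = Fi⊆ext (g∈⋂F i)

    in-⋂ : P▼.ext (λ d → Σ I λ i → F i ≐ P.ext d) ⊆ ⋂ F
    in-⋂ g∈ext▼ i = proj₂ (proj₂ (definable i)) (g∈ext▼ (i , proj₂ (definable i)))

  definable▼⇔⋂ : (A : Pred G ℓ) →
    P▼.Definable A
    ⇔ (Σ (Set ℓ) λ I → Σ (I → Pred G ℓ) λ F → (∀ i → P.Definable (F i)) × (A ≐ ⋂ F))
  definable▼⇔⋂ A = mk⇔ to from
    where
    to : P▼.Definable A →
         Σ (Set ℓ) λ I → Σ (I → Pred G ℓ) λ F → (∀ i → P.Definable (F i)) × (A ≐ ⋂ F)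
    to (S , A≐ext▼S) =
      Σ D S , (λ p → P.ext (proj₁ p)) , (λ p → proj₁ p , (λ x → x) , (λ x → x))
      , ≐-trans A≐ext▼S (ext▼-is-⋂ S)

    from : (Σ (Set ℓ) λ I → Σ (I → Pred G ℓ) λ F → (∀ i → P.Definable (F i)) × (A ≐ ⋂ F)) →
           P▼.Definable A
    from (I , F , definable , A≐⋂F) =
      (λ d → Σ I λ i → F i ≐ P.ext d) , ≐-trans A≐⋂F (⋂-is-ext▼ F definable)

-- Theorem 8.7.
theorem8p7 : ∀ {ℓ : Level} (G D : Set ℓ) (_⊑_ : D → D → Set ℓ) (δ : G → D) →
    IsPartialOrder _≡_ _⊑_ →
    let open Down G D _⊑_ δ in
    P▼.IsPatternStructure ℓ
    × (∀ (S : Pred D ℓ) → P▼.ext S ≐ (λ g → ∀ d → S d → P.ext d g))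
    × (∀ (A : Pred G ℓ) → P▼.IsIntent A (P.cov A))
    × (∀ (A : Pred G ℓ) →
         P▼.Definable A
         ⇔ (Σ (Set ℓ) λ I → Σ (I → Pred G ℓ) λ F →
              (∀ i → P.Definable (F i)) × (A ≐ ⋂ F)))
theorem8p7 G D _⊑_ δ _ =
    isPatternStructure , ext▼-pointwise , intent-is-⋂ , definable▼⇔⋂
  where
  open Down G D _⊑_ δ using (δ▼)
  open Powerset G D δ▼
  open DownSetup G D _⊑_ δ
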